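{- Let $(\mathcal{M}_1,\boldsymbol\gamma_1)$ and $(\mathcal{M}_2,\boldsymbol\gamma_2)$ be weighted binary matroids with $E(\mathcal{M}_1)\cap E(\mathcal{M}_2)=\{p\}$, where $p$ is not a loop in either $\mathcal{M}_1$ or $\mathcal{M}_2$. Let $\boldsymbol\gamma=\boldsymbol\gamma_1\triangle\boldsymbol\gamma_2$ be the weighting on $E(\mathcal{M}_1\triangle\mathcal{M}_2)$ inherited from $\boldsymbol\gamma_1$ and $\boldsymbol\gamma_2$. Then $$\tilde Z(\mathcal{M}_1\triangle\mathcal{M}_2;\boldsymbol\gamma)=\big(\tilde Z(\mathcal{M}_1\backslash p;\boldsymbol\gamma_1),\tilde Z(\mathcal{M}_1/p;\boldsymbol\gamma_1)\big)\begin{pmatrix}2&-1\\-1&1\end{pmatrix}\begin{pmatrix}\tilde Z(\mathcal{M}_2\backslash p;\boldsymbol\gamma_2)\\ \tilde Z(\mathcal{M}_2/p;\boldsymbol\gamma_2)\end{pmatrix}.$$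
   Context: A weighted matroid $(\mathcal{M},\boldsymbol\gamma)$ is a matroid with weights $\gamma_e\ge 0$ for $e\in E(\mathcal{M})$; for any matroid $\mathcal{N}$ whose ground set is a subset of the domain of the weights, $\tilde Z(\mathcal{N};\boldsymbol\gamma)=\sum_{A\subseteq E(\mathcal{N})}\gamma_A 2^{ -r_{\mathcal{N}}(A)}$ with $\gamma_A=\prod_{e\in A}\gamma_e$. A loop is a one-element circuit. Deletion: $\mathcal{M}\backslash T$ is the matroid on $E-T$ with $r(A)=r_{\mathcal{M}}(A)$; contraction: $\mathcal{M}/T$ is the matroid on $E-T$ with $r(A)=r_{\mathcal{M}}(A\cup T)-r_{\mathcal{M}}(T)$. A cycle is a disjoint union of circuits; for binary matroids the cycles form a $\mathrm{GF}(2)$-vector space determining the matroid. For binary matroids $\mathcal{M}_1,\mathcal{M}_2$ with $E(\mathcal{M}_1)=E_1\cup T$, $E(\mathcal{M}_2)=E_2\cup T$, $E_1,E_2,T$ pairwise disjoint, the delta-sum $\mathcal{M}_1\triangle\mathcal{M}_2$ is the binary matroid on $E_1\cup E_2$ whose cycles are the sets $C_1\oplus C_2\subseteq E_1\cup E_2$ with $C_i$ a cycle of $\mathcal{M}_i$ ($\oplus$ = symmetric difference). The inherited weighting $\boldsymbol\gamma_1\triangle\boldsymbol\gamma_2$ agrees with $\boldsymbol\gamma_1$ on $E_1$ and with $\boldsymbol\gamma_2$ on $E_2$. -}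

module Defs where

open import Level using (Level)
open import Data.Nat using (ℕ; zero; suc; _+_; _≤_; _<_; _∸_)
open import Data.Bool using (Bool; true; false; _xor_; if_then_else_)
open import Data.Fin using (Fin) renaming (zero to fzero; suc to fsuc)
open import Data.Fin.Subset
  using (Subset; inside; outside; _∈_; _⊆_; _∪_; _∩_; ⊥; ⁅_⁆; ∣_∣; ⋃; Nonempty; Empty)
open import Data.Vec using (Vec; []; _∷_; replicate; zipWith; _++_; head; tail)
open import Data.List using (List)
open import Data.List.Relation.Unary.All using (All)
open import Data.List.Relation.Unary.AllPairs using (AllPairs)
open import Data.Product using (Σ; ∃; ∃-syntax; _×_)
open import Relation.Nullary using (¬_)
open import Relation.Binary.PropositionalEquality using (_≡_; _≢_)
open import Algebra.Bundles using (CommutativeRing)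

record Matroid (n : ℕ) : Set where
  field
    rank      : Subset n → ℕ
    rank-≤    : ∀ A → rank A ≤ ∣ A ∣
    rank-mono : ∀ A B → A ⊆ B → rank A ≤ rank B
    rank-sub  : ∀ A B → rank (A ∪ B) + rank (A ∩ B) ≤ rank A + rank B
open Matroid public

zeroV : ∀ {m} → Vec Bool m
zeroV = replicate _ false

_⊕V_ : ∀ {m} → Vec Bool m → Vec Bool m → Vec Bool m
_⊕V_ = zipWith _xor_

colSum : ∀ {m n} → (Fin n → Vec Bool m) → Subset n → Vec Bool m
colSum {n = zero}  cols []      = zeroV
colSum {n = suc n} cols (b ∷ S) =
  (if b then cols fzero else zeroV) ⊕V colSum (λ i → cols (fsuc i)) S

LinIndep : ∀ {m n} → (Fin n → Vec Bool m) → Subset n → Set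
LinIndep cols B = ∀ S → S ⊆ B → Nonempty S → colSum cols S ≢ zeroV

IsGF2Rank : ∀ {m n} → (Fin n → Vec Bool m) → Subset n → ℕ → Set
IsGF2Rank cols A k =
  (∃[ B ] (B ⊆ A × LinIndep cols B × ∣ B ∣ ≡ k))
  × (∀ B → B ⊆ A → LinIndep cols B → ∣ B ∣ ≤ k)

IsBinary : ∀ {n} → Matroid n → Set
IsBinary {n} M =
  ∃[ m ] Σ (Fin n → Vec Bool m) λ cols → ∀ A → IsGF2Rank cols A (rank M A)

Dependent : ∀ {n} → Matroid n → Subset n → Set
Dependent M A = rank M A < ∣ A ∣

IsCircuit : ∀ {n} → Matroid n → Subset n → Set
IsCircuit M C = Dependent M C × (∀ D → D ⊆ C → Dependent M D → C ⊆ D)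

Disjoint : ∀ {n} → Subset n → Subset n → Set
Disjoint A B = Empty (A ∩ B)

IsCycle : ∀ {n} → Matroid n → Subset n → Set
IsCycle M C =
  ∃[ Cs ] (All (IsCircuit M) Cs × AllPairs Disjoint Cs × ⋃ Cs ≡ C)

IsLoop : ∀ {n} → Matroid n → Fin n → Set
IsLoop M e = IsCircuit M ⁅ e ⁆

-- Deletion and contraction of the element zero of Fin (suc n)
-- (which plays the role of the common element p); only the rank
-- functions are needed.

deleteRank : ∀ {n} → Matroid (suc n) → Subset n → ℕ
deleteRank M A = rank M (outside ∷ A)

contractRank : ∀ {n} → Matroid (suc n) → Subset n → ℕ
contractRank M A = rank M (inside ∷ A) ∸ rank M (inside ∷ ⊥)

-- The delta-sum: M is (the) delta-sum of M₁ (on {p} ∪ E₁ = Fin (suc n₁),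
-- p = zero) and M₂ (on {p} ∪ E₂ = Fin (suc n₂), p = zero), on the ground
-- set E₁ ∪ E₂ = Fin (n₁ + n₂) (E₁ first, then E₂), iff M is binary and
-- its cycles are exactly the sets C₁ ⊕ C₂ ⊆ E₁ ∪ E₂ with Cᵢ a cycle of Mᵢ.
-- C₁ ⊕ C₂ avoids p iff both or neither of C₁, C₂ contain p; it then
-- equals (C₁ - p) ∪ (C₂ - p).

IsDeltaSum : ∀ {n₁ n₂} → Matroid (suc n₁) → Matroid (suc n₂)
           → Matroid (n₁ + n₂) → Set
IsDeltaSum M₁ M₂ M =
  IsBinary M ×
  (∀ C → IsCycle M C ⇔′ (∃[ C₁ ] ∃[ C₂ ] (IsCycle M₁ C₁ × IsCycle M₂ C₂
          × head C₁ ≡ head C₂ × C ≡ tail C₁ ++ tail C₂)))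
  where
  _⇔′_ : Set → Set → Set
  P ⇔′ Q = (P → Q) × (Q → P)

-- The weighted sum  Z̃(N; γ) = Σ_{A ⊆ E(N)} γ_A 2^{-r_N(A)},
-- with values in a commutative ring R, where `half` is an element with
-- half + half ≈ 1 (so half = 2⁻¹).

module _ {c ℓ : Level} (R : CommutativeRing c ℓ) where
  open CommutativeRing R using (Carrier; 1#) renaming (_+_ to _+R_; _*_ to _*R_)

  pow : Carrier → ℕ → Carrier
  pow x zero    = 1#
  pow x (suc k) = x *R pow x k

  weightProd : ∀ {n} → (Fin n → Carrier) → Subset n → Carrier
  weightProd {zero}  γ []            = 1#
  weightProd {suc n} γ (inside ∷ A)  = γ fzero *R weightProd (λ i → γ (fsuc i)) A
  weightProd {suc n} γ (outside ∷ A) = weightProd (λ i → γ (fsuc i)) A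

  sumSubsets : ∀ {n} → (Subset n → Carrier) → Carrier
  sumSubsets {zero}  f = f []
  sumSubsets {suc n} f =
    sumSubsets (λ A → f (outside ∷ A)) +R sumSubsets (λ A → f (inside ∷ A))

  Ztilde : ∀ {n} → Carrier → (Subset n → ℕ) → (Fin n → Carrier) → Carrier
  Ztilde half r γ = sumSubsets (λ A → weightProd γ A *R pow half (r A))

-- Let c represent a binary matroid over GF(2) and let χ S be 1 if the columns of S sum to 0
-- (S is a cycle) and 0 otherwise.  Rank–nullity, 2^(|A| - r(A)) = #{S ⊆ A | χ S = 1}, turns Z̃ into
-- Ψ (γ/2) χ = Σ_A (γ/2)_A Σ_{S ⊆ A} χ S.  Writing a and b for χ restricted to the cycles avoiding
-- and containing p, this gives Z̃(M\p) = Ψ a and, since r(p) = 1, Z̃(M/p) = Ψ a + Ψ b.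
-- A cycle of M₁ △ M₂ is C₁ ⊕ C₂ with both or neither of the Cᵢ through p; as p is not a loop the
-- two cases exclude each other, so χ (S₁ ∪ S₂) = a₁ S₁ a₂ S₂ + b₁ S₁ b₂ S₂.  Since Ψ factorises
-- over E₁ ⊎ E₂, Z̃(M₁ △ M₂) = Ψ a₁ Ψ a₂ + Ψ b₁ Ψ b₂, which is the stated bilinear form.

module Submission where

open import Defs
open import Data.Nat using (ℕ; zero; suc; _≤_; _<_; s≤s) renaming (_+_ to _+ℕ_; _∸_ to _∸ℕ_)
open import Data.Nat.Properties using (≤-refl; ≤-trans; n≤1+n; <-irrefl; <-≤-trans; ≤-antisym; ≮⇒≥; n≮0)
open import Data.Nat.Induction using (<-wellFounded)
open import Induction.WellFounded using (Acc; acc)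
open import Data.Bool using (Bool; true; false; _xor_; if_then_else_)
open import Data.Bool.Properties using (xor-assoc; xor-comm; xor-identityˡ; xor-identityʳ; xor-same)
  renaming (_≟_ to _≟ᴮ_)
open import Data.Fin using (Fin; splitAt) renaming (zero to fzero; suc to fsuc)
open import Data.Fin.Properties using (any?; ¬∀⟶∃¬)
open import Data.Fin.Subset
  using (Subset; inside; outside; _∈_; _∉_; _⊆_; _⊈_; _∪_; ⊥; ⁅_⁆; ∣_∣; ⋃; Nonempty)
open import Data.Fin.Subset.Properties
  using (_∈?_; _⊆?_; nonempty?; anySubset?; ⊆-refl; ⊆-trans; ⊆-antisym; out⊆; in⊆in; drop-∷-⊆;
         drop-there; ⊥⊆; ∉⊥; ∣⊥∣≡0; Empty-unique; p⊂q⇒∣p∣<∣q∣; x∈p∩q⁻; x∈p∩q⁺; x∈p∪q⁻;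
         p⊆p∪q; q⊆p∪q; p∩q⊆q; x∈⁅y⁆⇒x≡y; x∈⁅x⁆; ∣⁅x⁆∣≡1)
open import Data.Vec using (Vec; []; _∷_; _++_)
open import Data.Vec.Properties
  using (≡-dec; zipWith-assoc; zipWith-comm; zipWith-identityˡ; zipWith-identityʳ;
         ++-injectiveˡ; ++-injectiveʳ)
open import Data.Vec.Base using (here; there)
open import Data.List using (List; []; _∷_)
open import Data.List.Relation.Unary.All using (All; []; _∷_)
open import Data.List.Relation.Unary.AllPairs using (AllPairs; []; _∷_)
open import Data.Product using (∃-syntax; _×_; _,_; proj₁; proj₂)
open import Data.Sum using (_⊎_; inj₁; inj₂; [_,_])
open import Data.Sum.Properties using ([,]-map; [,]-∘)
open import Data.Empty using (⊥-elim)
open import Function using (_∘_)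
open import Relation.Nullary using (¬_; Dec; yes; no; contradiction)
open import Relation.Nullary.Decidable using (_×-dec_; _⊎-dec_; ¬?; _→-dec_)
open import Algebra.Bundles using (CommutativeRing)
open import Relation.Binary.PropositionalEquality
  using (_≡_; _≢_; refl; sym; trans; cong; cong₂; subst; module ≡-Reasoning)

private
  variable
    m n n′ : ℕ

-- Vectors and column sums over GF(2)

⊕-identityˡ : (x : Vec Bool m) → zeroV ⊕V x ≡ x
⊕-identityˡ = zipWith-identityˡ xor-identityˡ

⊕-identityʳ : (x : Vec Bool m) → x ⊕V zeroV ≡ x
⊕-identityʳ = zipWith-identityʳ xor-identityʳ

⊕-comm : (x y : Vec Bool m) → x ⊕V y ≡ y ⊕V x
⊕-comm = zipWith-comm xor-comm

⊕-assoc : (x y z : Vec Bool m) → (x ⊕V y) ⊕V z ≡ x ⊕V (y ⊕V z)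
⊕-assoc = zipWith-assoc xor-assoc

⊕-self : (x : Vec Bool m) → x ⊕V x ≡ zeroV
⊕-self []      = refl
⊕-self (a ∷ x) = cong₂ _∷_ (xor-same a) (⊕-self x)

⊕-interchange : (w x y z : Vec Bool m) → (w ⊕V x) ⊕V (y ⊕V z) ≡ (w ⊕V y) ⊕V (x ⊕V z)
⊕-interchange w x y z = begin
  (w ⊕V x) ⊕V (y ⊕V z)  ≡⟨ ⊕-assoc w x (y ⊕V z) ⟩
  w ⊕V (x ⊕V (y ⊕V z))  ≡⟨ cong (w ⊕V_) (sym (⊕-assoc x y z)) ⟩
  w ⊕V ((x ⊕V y) ⊕V z)  ≡⟨ cong (λ t → w ⊕V (t ⊕V z)) (⊕-comm x y) ⟩
  w ⊕V ((y ⊕V x) ⊕V z)  ≡⟨ cong (w ⊕V_) (⊕-assoc y x z) ⟩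
  w ⊕V (y ⊕V (x ⊕V z))  ≡⟨ sym (⊕-assoc w y (x ⊕V z)) ⟩
  (w ⊕V y) ⊕V (x ⊕V z)  ∎
  where open ≡-Reasoning

x⊕y≡0⇒x≡y : (x y : Vec Bool m) → x ⊕V y ≡ zeroV → x ≡ y
x⊕y≡0⇒x≡y x y x⊕y≡0 = begin
  x                 ≡⟨ sym (⊕-identityʳ x) ⟩
  x ⊕V zeroV        ≡⟨ cong (x ⊕V_) (sym (⊕-self y)) ⟩
  x ⊕V (y ⊕V y)     ≡⟨ sym (⊕-assoc x y y) ⟩
  (x ⊕V y) ⊕V y     ≡⟨ cong (_⊕V y) x⊕y≡0 ⟩
  zeroV ⊕V y        ≡⟨ ⊕-identityˡ y ⟩
  y                 ∎
  where open ≡-Reasoning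

x⊕[y⊕x]≡y : (x y : Vec Bool m) → x ⊕V (y ⊕V x) ≡ y
x⊕[y⊕x]≡y x y = begin
  x ⊕V (y ⊕V x)  ≡⟨ cong (x ⊕V_) (⊕-comm y x) ⟩
  x ⊕V (x ⊕V y)  ≡⟨ sym (⊕-assoc x x y) ⟩
  (x ⊕V x) ⊕V y  ≡⟨ cong (_⊕V y) (⊕-self x) ⟩
  zeroV ⊕V y     ≡⟨ ⊕-identityˡ y ⟩
  y              ∎
  where open ≡-Reasoning

if-xor : ∀ s t (v : Vec Bool m) →
  (if s xor t then v else zeroV) ≡ (if s then v else zeroV) ⊕V (if t then v else zeroV)
if-xor false false v = sym (⊕-identityˡ zeroV)
if-xor false true  v = sym (⊕-identityˡ v)
if-xor true  false v = sym (⊕-identityʳ v)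
if-xor true  true  v = sym (⊕-self v)

colSum-⊕ : (c : Fin n → Vec Bool m) (S T : Subset n) →
  colSum c (S ⊕V T) ≡ colSum c S ⊕V colSum c T
colSum-⊕ c []      []      = sym (⊕-identityˡ zeroV)
colSum-⊕ c (s ∷ S) (t ∷ T) =
  trans (cong₂ _⊕V_ (if-xor s t (c fzero)) (colSum-⊕ (c ∘ fsuc) S T)) (⊕-interchange _ _ _ _)

colSum-⊥ : (c : Fin n → Vec Bool m) → colSum c ⊥ ≡ zeroV
colSum-⊥ {n = zero}  c = refl
colSum-⊥ {n = suc n} c = trans (⊕-identityˡ _) (colSum-⊥ (c ∘ fsuc))

colSum-⁅⁆ : (c : Fin n → Vec Bool m) (i : Fin n) → colSum c ⁅ i ⁆ ≡ c i
colSum-⁅⁆ c fzero    = trans (cong (c fzero ⊕V_) (colSum-⊥ (c ∘ fsuc))) (⊕-identityʳ _)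
colSum-⁅⁆ c (fsuc i) = trans (⊕-identityˡ _) (colSum-⁅⁆ (c ∘ fsuc) i)

colSum-outside : (c : Fin (suc n) → Vec Bool m) (S : Subset n) →
  colSum c (outside ∷ S) ≡ colSum (c ∘ fsuc) S
colSum-outside c S = ⊕-identityˡ _

-- Symmetric differences of subsets

∈-⊕⁻ : (p q : Subset n) {x : Fin n} → x ∈ p ⊕V q → x ∈ p × x ∉ q ⊎ x ∉ p × x ∈ q
∈-⊕⁻ (true  ∷ p) (false ∷ q) here = inj₁ (here , λ ())
∈-⊕⁻ (false ∷ p) (true  ∷ q) here = inj₂ ((λ ()) , here)
∈-⊕⁻ (_ ∷ p) (_ ∷ q) (there x∈) with ∈-⊕⁻ p q x∈
... | inj₁ (x∈p , x∉q) = inj₁ (there x∈p , x∉q ∘ drop-there)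
... | inj₂ (x∉p , x∈q) = inj₂ (x∉p ∘ drop-there , there x∈q)

⊕-⊆ : {S T B : Subset n} → S ⊆ B → T ⊆ B → S ⊕V T ⊆ B
⊕-⊆ {S = S} {T} S⊆B T⊆B x∈ with ∈-⊕⁻ S T x∈
... | inj₁ (x∈S , _) = S⊆B x∈S
... | inj₂ (_ , x∈T) = T⊆B x∈T

⊕-⊆ˡ : {C D : Subset n} → D ⊆ C → C ⊕V D ⊆ C
⊕-⊆ˡ {C = C} {D} D⊆C x∈ with ∈-⊕⁻ C D x∈
... | inj₁ (x∈C , _)   = x∈C
... | inj₂ (x∉C , x∈D) = ⊥-elim (x∉C (D⊆C x∈D))

⊕⁅⁆-⊆ : {i : Fin n} {B A : Subset n} → B ⊆ A → i ∈ A → B ⊕V ⁅ i ⁆ ⊆ A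
⊕⁅⁆-⊆ {i = i} {B} B⊆A i∈A x∈ with ∈-⊕⁻ B ⁅ i ⁆ x∈
... | inj₁ (x∈B , _) = B⊆A x∈B
... | inj₂ (_ , x∈i) rewrite x∈⁅y⁆⇒x≡y i x∈i = i∈A

∣⊕⁅⁆∣ : (i : Fin n) (B : Subset n) → i ∉ B → ∣ B ⊕V ⁅ i ⁆ ∣ ≡ suc ∣ B ∣
∣⊕⁅⁆∣ fzero    (true  ∷ B) i∉B = ⊥-elim (i∉B here)
∣⊕⁅⁆∣ fzero    (false ∷ B) i∉B = cong (λ X → suc ∣ X ∣) (⊕-identityʳ B)
∣⊕⁅⁆∣ (fsuc i) (true  ∷ B) i∉B = cong suc (∣⊕⁅⁆∣ i B (i∉B ∘ there))
∣⊕⁅⁆∣ (fsuc i) (false ∷ B) i∉B = ∣⊕⁅⁆∣ i B (i∉B ∘ there)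


⊆-⊕⁅⁆-∈ : {i : Fin n} {T B : Subset n} → i ∈ T → T ⊆ B ⊕V ⁅ i ⁆ → T ⊕V ⁅ i ⁆ ⊆ B
⊆-⊕⁅⁆-∈ {i = i} {T} {B} i∈T T⊆ x∈ with ∈-⊕⁻ T ⁅ i ⁆ x∈
... | inj₂ (x∉T , x∈i) rewrite x∈⁅y⁆⇒x≡y i x∈i = ⊥-elim (x∉T i∈T)
... | inj₁ (x∈T , x∉i) with ∈-⊕⁻ B ⁅ i ⁆ (T⊆ x∈T)
...   | inj₁ (x∈B , _) = x∈B
...   | inj₂ (_ , x∈i) = ⊥-elim (x∉i x∈i)

⊆-⊕⁅⁆-∉ : {i : Fin n} {T B : Subset n} → i ∉ T → T ⊆ B ⊕V ⁅ i ⁆ → T ⊆ B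
⊆-⊕⁅⁆-∉ {i = i} {T} {B} i∉T T⊆ {x} x∈T with ∈-⊕⁻ B ⁅ i ⁆ (T⊆ x∈T)
... | inj₁ (x∈B , _) = x∈B
... | inj₂ (_ , x∈i) rewrite x∈⁅y⁆⇒x≡y i x∈i = ⊥-elim (i∉T x∈T)

⊈⇒∃∉ : {S B : Subset n} → S ⊈ B → ∃[ x ] x ∈ S × x ∉ B
⊈⇒∃∉ {n} {S} {B} S⊈B with ¬∀⟶∃¬ n (λ x → x ∈ S → x ∈ B) (λ x → x ∈? S →-dec x ∈? B) (λ h → S⊈B (h _))
... | x , ¬x∈S⇒x∈B with x ∈? S
...   | yes x∈S = x , x∈S , (λ x∈B → ¬x∈S⇒x∈B (λ _ → x∈B))
...   | no  x∉S = ⊥-elim (¬x∈S⇒x∈B (λ x∈S → contradiction x∈S x∉S))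

⊆∧⊈⇒∣∣< : {S B : Subset n} → S ⊆ B → B ⊈ S → ∣ S ∣ < ∣ B ∣
⊆∧⊈⇒∣∣< S⊆B B⊈S with ⊈⇒∃∉ B⊈S
... | x , x∈B , x∉S = p⊂q⇒∣p∣<∣q∣ (S⊆B , x , x∈B , x∉S)

Disjoint-⊆ʳ : {D E X : Subset n} → E ⊆ X → Disjoint D X → Disjoint D E
Disjoint-⊆ʳ {D = D} {E} E⊆X D#X (x , x∈D∩E) with x∈p∩q⁻ D E x∈D∩E
... | x∈D , x∈E = D#X (x , x∈p∩q⁺ (x∈D , E⊆X x∈E))

Disjoint-⋃ʳ : {D : Subset n} (Es : List (Subset n)) → All (Disjoint D) Es → Disjoint D (⋃ Es)
Disjoint-⋃ʳ {D = D} [] [] (x , x∈D∩⊥) = ∉⊥ (p∩q⊆q D ⊥ x∈D∩⊥)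
Disjoint-⋃ʳ {D = D} (E ∷ Es) (D#E ∷ D#Es) (x , x∈D∩) with x∈p∩q⁻ D (E ∪ ⋃ Es) x∈D∩
... | x∈D , x∈E∪ with x∈p∪q⁻ E (⋃ Es) x∈E∪
...   | inj₁ x∈E  = D#E (x , x∈p∩q⁺ (x∈D , x∈E))
...   | inj₂ x∈Es = Disjoint-⋃ʳ Es D#Es (x , x∈p∩q⁺ (x∈D , x∈Es))

Disjoint-⋃ʳ⁻ : {D : Subset n} (Es : List (Subset n)) → Disjoint D (⋃ Es) → All (Disjoint D) Es
Disjoint-⋃ʳ⁻ []       _    = []
Disjoint-⋃ʳ⁻ (E ∷ Es) D#Es =
  Disjoint-⊆ʳ (p⊆p∪q (⋃ Es)) D#Es ∷ Disjoint-⋃ʳ⁻ Es (Disjoint-⊆ʳ (q⊆p∪q E (⋃ Es)) D#Es)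

Disjoint-⊕ : {C D : Subset n} → D ⊆ C → Disjoint D (C ⊕V D)
Disjoint-⊕ {C = C} {D} D⊆C (x , x∈D∩) with x∈p∩q⁻ D (C ⊕V D) x∈D∩
... | x∈D , x∈C⊕D with ∈-⊕⁻ C D x∈C⊕D
...   | inj₁ (_ , x∉D) = x∉D x∈D
...   | inj₂ (x∉C , _) = x∉C (D⊆C x∈D)

∪≡⊕ : (D X : Subset n) → Disjoint D X → D ∪ X ≡ D ⊕V X
∪≡⊕ []          []          _   = refl
∪≡⊕ (true  ∷ D) (true  ∷ X) D#X = ⊥-elim (D#X (fzero , here))
∪≡⊕ (true  ∷ D) (false ∷ X) D#X = cong (true ∷_) (∪≡⊕ D X λ (x , x∈) → D#X (fsuc x , there x∈))
∪≡⊕ (false ∷ D) (b     ∷ X) D#X = cong (b ∷_)    (∪≡⊕ D X λ (x , x∈) → D#X (fsuc x , there x∈))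

∪-⊕-cancel : {C D : Subset n} → D ⊆ C → D ∪ (C ⊕V D) ≡ C
∪-⊕-cancel {C = C} {D} D⊆C = trans (∪≡⊕ D (C ⊕V D) (Disjoint-⊕ D⊆C)) (x⊕[y⊕x]≡y D C)

⊆⇒∣⊕∣< : {C D : Subset n} → D ⊆ C → Nonempty D → ∣ C ⊕V D ∣ < ∣ C ∣
⊆⇒∣⊕∣< D⊆C (x , x∈D) =
  ⊆∧⊈⇒∣∣< (⊕-⊆ˡ D⊆C) λ C⊆C⊕D → Disjoint-⊕ D⊆C (x , x∈p∩q⁺ (x∈D , C⊆C⊕D (D⊆C x∈D)))

-- Linear algebra over GF(2)

Kernel : (Fin n → Vec Bool m) → Subset n → Set
Kernel c S = colSum c S ≡ zeroV

kernel? : (c : Fin n → Vec Bool m) (S : Subset n) → Dec (Kernel c S)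
kernel? c S = ≡-dec _≟ᴮ_ (colSum c S) zeroV

InSpan : (Fin n → Vec Bool m) → Subset n → Vec Bool m → Set
InSpan c B v = ∃[ S ] S ⊆ B × colSum c S ≡ v

Kernel-⊕ : (c : Fin n → Vec Bool m) {S T : Subset n} → Kernel c S → Kernel c T → Kernel c (S ⊕V T)
Kernel-⊕ c {S} {T} kerS kerT = trans (colSum-⊕ c S T) (trans (cong₂ _⊕V_ kerS kerT) (⊕-identityˡ zeroV))

colSum-closed : (Q : Vec Bool m → Set) → Q zeroV → (∀ {u v} → Q u → Q v → Q (u ⊕V v)) →
  (c : Fin n → Vec Bool m) (S : Subset n) → (∀ {i} → i ∈ S → Q (c i)) → Q (colSum c S)
colSum-closed Q Q0 Q⊕ c []          QS = Q0
colSum-closed Q Q0 Q⊕ c (true  ∷ S) QS = Q⊕ (QS here) (colSum-closed Q Q0 Q⊕ (c ∘ fsuc) S (QS ∘ there))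
colSum-closed Q Q0 Q⊕ c (false ∷ S) QS = Q⊕ Q0        (colSum-closed Q Q0 Q⊕ (c ∘ fsuc) S (QS ∘ there))

module _ (c : Fin n → Vec Bool m) where

  inSpan? : ∀ B v → Dec (InSpan c B v)
  inSpan? B v = anySubset? λ S → S ⊆? B ×-dec ≡-dec _≟ᴮ_ (colSum c S) v

  InSpan-zero : ∀ {B} → InSpan c B zeroV
  InSpan-zero = ⊥ , ⊥⊆ , colSum-⊥ c

  InSpan-⊆ : ∀ {A B v} → A ⊆ B → InSpan c A v → InSpan c B v
  InSpan-⊆ A⊆B (S , S⊆A , colSum≡v) = S , ⊆-trans S⊆A A⊆B , colSum≡v

  InSpan-⊕ : ∀ {B u v} → InSpan c B u → InSpan c B v → InSpan c B (u ⊕V v)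
  InSpan-⊕ (S , S⊆B , refl) (T , T⊆B , refl) = S ⊕V T , ⊕-⊆ S⊆B T⊆B , colSum-⊕ c S T

  ∃column∉span : ∀ {A B v} → InSpan c A v → ¬ InSpan c B v → ∃[ i ] i ∈ A × ¬ InSpan c B (c i)
  ∃column∉span {A} {B} (S , S⊆A , refl) v∉span with any? (λ i → i ∈? A ×-dec ¬? (inSpan? B (c i)))
  ... | yes found = found
  ... | no  none  = ⊥-elim (v∉span (colSum-closed (InSpan c B) InSpan-zero InSpan-⊕ c S column∈span))
    where
    column∈span : ∀ {i} → i ∈ S → InSpan c B (c i)
    column∈span {i} i∈S with inSpan? B (c i)
    ... | yes i∈span = i∈span
    ... | no  i∉span = ⊥-elim (none (i , S⊆A i∈S , i∉span))

  LinIndep-⊆ : ∀ {B S} → LinIndep c B → S ⊆ B → LinIndep c S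
  LinIndep-⊆ indB S⊆B T T⊆S = indB T (⊆-trans T⊆S S⊆B)

  ¬LinIndep⇒kernel : ∀ {D} → ¬ LinIndep c D → ∃[ T ] T ⊆ D × Nonempty T × Kernel c T
  ¬LinIndep⇒kernel {D} ¬indD with anySubset? (λ T → T ⊆? D ×-dec nonempty? T ×-dec kernel? c T)
  ... | yes found = found
  ... | no  none  = ⊥-elim (¬indD λ T T⊆D neT kerT → none (T , T⊆D , neT , kerT))

  LinIndep-⊕⁅⁆ : ∀ {B i} → LinIndep c B → ¬ InSpan c B (c i) → LinIndep c (B ⊕V ⁅ i ⁆)
  LinIndep-⊕⁅⁆ {B} {i} indB i∉span T T⊆ neT kerT with i ∈? T
  ... | yes i∈T = i∉span (T ⊕V ⁅ i ⁆ , ⊆-⊕⁅⁆-∈ i∈T T⊆ ,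
    trans (colSum-⊕ c T ⁅ i ⁆) (trans (cong₂ _⊕V_ kerT (colSum-⁅⁆ c i)) (⊕-identityˡ (c i))))
  ... | no  i∉T = indB T (⊆-⊕⁅⁆-∉ i∉T T⊆) neT kerT

  ∉span⇒∉ : ∀ {B i} → ¬ InSpan c B (c i) → i ∉ B
  ∉span⇒∉ {B} {i} i∉span i∈B =
    i∉span (⁅ i ⁆ , (λ x∈⁅i⁆ → subst (_∈ B) (sym (x∈⁅y⁆⇒x≡y i x∈⁅i⁆)) i∈B) , colSum-⁅⁆ c i)

  IsGF2Rank-unique : ∀ {A k l} → IsGF2Rank c A k → IsGF2Rank c A l → k ≡ l
  IsGF2Rank-unique ((B , B⊆A , indB , refl) , maxk) ((C , C⊆A , indC , refl) , maxl) =
    ≤-antisym (maxl B B⊆A indB) (maxk C C⊆A indC)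

  kernel⇒rank< : ∀ {S k} → IsGF2Rank c S k → Nonempty S → Kernel c S → k < ∣ S ∣
  kernel⇒rank< {S} ((B , B⊆S , indB , refl) , _) neS kerS with S ⊆? B
  ... | yes S⊆B = ⊥-elim (indB S S⊆B neS kerS)
  ... | no  S⊈B = ⊆∧⊈⇒∣∣< B⊆S S⊈B

  rank<⇒¬LinIndep : ∀ {D k} → IsGF2Rank c D k → k < ∣ D ∣ → ¬ LinIndep c D
  rank<⇒¬LinIndep (_ , maxk) k<∣D∣ indD = <-irrefl refl (<-≤-trans k<∣D∣ (maxk _ ⊆-refl indD))

IsGF2Rank-[] : (c : Fin 0 → Vec Bool m) {k : ℕ} → IsGF2Rank c [] k → k ≡ 0
IsGF2Rank-[] c (([] , _ , _ , ∣[]∣≡k) , _) = sym ∣[]∣≡k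

-- Cycles and loops of a binary matroid

Dependent⇒Nonempty : (M : Matroid n) {D : Subset n} → Dependent M D → Nonempty D
Dependent⇒Nonempty {n} M {D} depD with nonempty? D
... | yes neD  = neD
... | no  ¬neD =
  contradiction (subst (rank M D <_) (trans (cong ∣_∣ (Empty-unique ¬neD)) (∣⊥∣≡0 n)) depD) n≮0

cycle-⊕-circuit : (M : Matroid n) {C D : Subset n} →
  D ⊆ C → IsCircuit M D → IsCycle M (C ⊕V D) → IsCycle M C
cycle-⊕-circuit M {C} {D} D⊆C circD (Cs , circs , disj , ⋃Cs≡C⊕D) =
  D ∷ Cs , circD ∷ circs ,
  Disjoint-⋃ʳ⁻ Cs (subst (Disjoint D) (sym ⋃Cs≡C⊕D) (Disjoint-⊕ D⊆C)) ∷ disj ,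
  trans (cong (D ∪_) ⋃Cs≡C⊕D) (∪-⊕-cancel D⊆C)

module _ (M : Matroid n) {c : Fin n → Vec Bool m} (rep : ∀ A → IsGF2Rank c A (rank M A)) where

  kernel⇒Dependent : ∀ {S} → Nonempty S → Kernel c S → Dependent M S
  kernel⇒Dependent {S} = kernel⇒rank< c (rep S)

  Dependent⇒kernel : ∀ {D} → Dependent M D → ∃[ T ] T ⊆ D × Nonempty T × Kernel c T
  Dependent⇒kernel {D} depD = ¬LinIndep⇒kernel c (rank<⇒¬LinIndep c (rep D) depD)

  circuit⇒kernel : ∀ {C} → IsCircuit M C → Kernel c C
  circuit⇒kernel (depC , minC) with Dependent⇒kernel depC
  ... | T , T⊆C , neT , kerT =
    subst (Kernel c) (⊆-antisym T⊆C (minC T T⊆C (kernel⇒Dependent neT kerT))) kerT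

  ⋃-kernel : ∀ Cs → All (IsCircuit M) Cs → AllPairs Disjoint Cs → Kernel c (⋃ Cs)
  ⋃-kernel []       []             []             = colSum-⊥ c
  ⋃-kernel (C ∷ Cs) (circC ∷ circs) (C#Cs ∷ disj) =
    subst (Kernel c) (sym (∪≡⊕ C (⋃ Cs) (Disjoint-⋃ʳ Cs C#Cs)))
      (Kernel-⊕ c (circuit⇒kernel circC) (⋃-kernel Cs circs disj))

  cycle⇒kernel : ∀ {C} → IsCycle M C → Kernel c C
  cycle⇒kernel (Cs , circs , disj , refl) = ⋃-kernel Cs circs disj

  -- A minimal nonempty kernel subset of X is a circuit.
  kernel⇒∃circuit : ∀ {X} → Nonempty X → Kernel c X → ∃[ D ] D ⊆ X × IsCircuit M D
  kernel⇒∃circuit {X} = search X (<-wellFounded ∣ X ∣)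
    where
    search : ∀ X → Acc _<_ ∣ X ∣ → Nonempty X → Kernel c X → ∃[ D ] D ⊆ X × IsCircuit M D
    search X (acc rec) neX kerX
      with anySubset? (λ Y → Y ⊆? X ×-dec nonempty? Y ×-dec kernel? c Y ×-dec ¬? (X ⊆? Y))
    ... | yes (Y , Y⊆X , neY , kerY , X⊈Y) with search Y (rec (⊆∧⊈⇒∣∣< Y⊆X X⊈Y)) neY kerY
    ...   | D , D⊆Y , circD = D , ⊆-trans D⊆Y Y⊆X , circD
    search X (acc rec) neX kerX
        | no noSmaller = X , ⊆-refl , kernel⇒Dependent neX kerX , minimal
      where
      minimal : ∀ D → D ⊆ X → Dependent M D → X ⊆ D
      minimal D D⊆X depD with Dependent⇒kernel depD
      ... | T , T⊆D , neT , kerT with X ⊆? T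
      ...   | yes X⊆T = ⊆-trans X⊆T T⊆D
      ...   | no  X⊈T = ⊥-elim (noSmaller (T , ⊆-trans T⊆D D⊆X , neT , kerT , X⊈T))

  kernel⇒cycle : ∀ {C} → Kernel c C → IsCycle M C
  kernel⇒cycle {C} = build C (<-wellFounded ∣ C ∣)
    where
    build : ∀ C → Acc _<_ ∣ C ∣ → Kernel c C → IsCycle M C
    build C _ kerC with nonempty? C
    ... | no ¬neC = [] , [] , [] , sym (Empty-unique ¬neC)
    build C (acc rec) kerC | yes neC with kernel⇒∃circuit neC kerC
    ... | D , D⊆C , circD = cycle-⊕-circuit M D⊆C circD (build (C ⊕V D) (rec ∣C⊕D∣<∣C∣) kerC⊕D)
      where
      ∣C⊕D∣<∣C∣ : ∣ C ⊕V D ∣ < ∣ C ∣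
      ∣C⊕D∣<∣C∣ = ⊆⇒∣⊕∣< D⊆C (Dependent⇒Nonempty M (proj₁ circD))
      kerC⊕D : Kernel c (C ⊕V D)
      kerC⊕D = Kernel-⊕ c kerC (circuit⇒kernel circD)

Dependent-⁅⁆⇒loop : (M : Matroid n) (i : Fin n) → Dependent M ⁅ i ⁆ → IsLoop M i
Dependent-⁅⁆⇒loop M i dep = dep , minimal
  where
  minimal : ∀ D → D ⊆ ⁅ i ⁆ → Dependent M D → ⁅ i ⁆ ⊆ D
  minimal D D⊆⁅i⁆ depD y∈⁅i⁆ with Dependent⇒Nonempty M depD
  ... | x , x∈D = subst (_∈ D) (trans (x∈⁅y⁆⇒x≡y i (D⊆⁅i⁆ x∈D)) (sym (x∈⁅y⁆⇒x≡y i y∈⁅i⁆))) x∈D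

¬loop⇒rank⁅⁆≡1 : (M : Matroid n) (i : Fin n) → ¬ IsLoop M i → rank M ⁅ i ⁆ ≡ 1
¬loop⇒rank⁅⁆≡1 M i ¬loop = ≤-antisym (subst (rank M ⁅ i ⁆ ≤_) (∣⁅x⁆∣≡1 i) (rank-≤ M ⁅ i ⁆))
  (≮⇒≥ λ r<1 → ¬loop (Dependent-⁅⁆⇒loop M i (subst (rank M ⁅ i ⁆ <_) (sym (∣⁅x⁆∣≡1 i)) r<1)))

¬loop⇒column≢0 : (M : Matroid n) {c : Fin n → Vec Bool m} → (∀ A → IsGF2Rank c A (rank M A)) →
  (i : Fin n) → ¬ IsLoop M i → c i ≢ zeroV
¬loop⇒column≢0 M {c} rep i ¬loop cᵢ≡0 =
  ¬loop (Dependent-⁅⁆⇒loop M i (kernel⇒Dependent M rep (i , x∈⁅x⁆ i) (trans (colSum-⁅⁆ c i) cᵢ≡0)))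

kernel-outside⇒¬kernel-inside : (M : Matroid (suc n)) {c : Fin (suc n) → Vec Bool m} →
  (∀ A → IsGF2Rank c A (rank M A)) → ¬ IsLoop M fzero →
  ∀ {S} → Kernel c (outside ∷ S) → ¬ Kernel c (inside ∷ S)
kernel-outside⇒¬kernel-inside M {c} rep ¬loop {S} kerₒ kerᵢ =
  ¬loop⇒column≢0 M rep fzero ¬loop (begin
    c fzero                ≡⟨ x⊕y≡0⇒x≡y (c fzero) (colSum (c ∘ fsuc) S) kerᵢ ⟩
    colSum (c ∘ fsuc) S    ≡⟨ sym (colSum-outside c S) ⟩
    colSum c (outside ∷ S) ≡⟨ kerₒ ⟩
    zeroV                  ∎)
  where open ≡-Reasoning

-- Adding the element fzero

∣x∷p∣≤1+∣p∣ : (x : Bool) (p : Subset n) → ∣ x ∷ p ∣ ≤ suc ∣ p ∣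
∣x∷p∣≤1+∣p∣ true  p = ≤-refl
∣x∷p∣≤1+∣p∣ false p = n≤1+n _

fzero∉outside : {A : Subset n} → fzero ∉ outside ∷ A
fzero∉outside ()

module _ (c : Fin (suc n) → Vec Bool m) where

  kernel-inside⇒colSum : ∀ {S} → Kernel c (inside ∷ S) → colSum (c ∘ fsuc) S ≡ c fzero
  kernel-inside⇒colSum {S} ker = sym (x⊕y≡0⇒x≡y (c fzero) (colSum (c ∘ fsuc) S) ker)

  colSum-inside-translate : ∀ {S₀} → colSum (c ∘ fsuc) S₀ ≡ c fzero →
    ∀ S → colSum c (inside ∷ S) ≡ colSum c (outside ∷ (S ⊕V S₀))
  colSum-inside-translate {S₀} colSum≡c₀ S = begin
    c fzero ⊕V colSum (c ∘ fsuc) S                  ≡⟨ cong (_⊕V colSum (c ∘ fsuc) S) (sym colSum≡c₀) ⟩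
    colSum (c ∘ fsuc) S₀ ⊕V colSum (c ∘ fsuc) S     ≡⟨ ⊕-comm _ _ ⟩
    colSum (c ∘ fsuc) S ⊕V colSum (c ∘ fsuc) S₀     ≡⟨ sym (colSum-⊕ (c ∘ fsuc) S S₀) ⟩
    colSum (c ∘ fsuc) (S ⊕V S₀)                     ≡⟨ sym (colSum-outside c (S ⊕V S₀)) ⟩
    colSum c (outside ∷ (S ⊕V S₀))                  ∎
    where open ≡-Reasoning

  LinIndep-outside⁻ : ∀ {B} → LinIndep c (outside ∷ B) → LinIndep (c ∘ fsuc) B
  LinIndep-outside⁻ indB S S⊆B (x , x∈S) ker =
    indB (outside ∷ S) (out⊆ S⊆B) (fsuc x , there x∈S) (trans (colSum-outside c S) ker)

  LinIndep-outside⁺ : ∀ {B} → LinIndep (c ∘ fsuc) B → LinIndep c (outside ∷ B)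
  LinIndep-outside⁺ indB (outside ∷ S) S⊆ (fsuc x , there x∈S) ker =
    indB S (drop-∷-⊆ S⊆) (x , x∈S) (trans (sym (colSum-outside c S)) ker)
  LinIndep-outside⁺ indB (inside ∷ S) S⊆ _ _ = ⊥-elim (fzero∉outside (S⊆ here))

  LinIndep-inside⁺ : ∀ {B} → LinIndep c (outside ∷ B) → ¬ InSpan (c ∘ fsuc) B (c fzero) →
    LinIndep c (inside ∷ B)
  LinIndep-inside⁺ indB _       (outside ∷ T) T⊆ = indB (outside ∷ T) (out⊆ (drop-∷-⊆ T⊆))
  LinIndep-inside⁺ indB c₀∉span (inside ∷ T)  T⊆ _ ker =
    c₀∉span (T , drop-∷-⊆ T⊆ , kernel-inside⇒colSum ker)

  LinIndep-inside⇒∉span : ∀ {B} → LinIndep c (inside ∷ B) → ¬ InSpan (c ∘ fsuc) B (c fzero)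
  LinIndep-inside⇒∉span indB (S , S⊆B , colSum≡c₀) = indB (inside ∷ S) (in⊆in S⊆B) (fzero , here)
    (trans (cong (c fzero ⊕V_) colSum≡c₀) (⊕-self (c fzero)))

  IsGF2Rank-outside : ∀ {A k} → IsGF2Rank c (outside ∷ A) k → IsGF2Rank (c ∘ fsuc) A k
  IsGF2Rank-outside ((inside ∷ B , B⊆ , _) , _) = ⊥-elim (fzero∉outside (B⊆ here))
  IsGF2Rank-outside ((outside ∷ B , B⊆ , indB , ∣B∣≡k) , maxk) =
    (B , drop-∷-⊆ B⊆ , LinIndep-outside⁻ indB , ∣B∣≡k) ,
    λ B′ B′⊆A indB′ → maxk (outside ∷ B′) (out⊆ B′⊆A) (LinIndep-outside⁺ indB′)

  IsGF2Rank-inside-∉span : ∀ {A k} → IsGF2Rank c (outside ∷ A) k →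
    ¬ InSpan (c ∘ fsuc) A (c fzero) → IsGF2Rank c (inside ∷ A) (suc k)
  IsGF2Rank-inside-∉span ((inside ∷ B , B⊆ , _) , _) _ = ⊥-elim (fzero∉outside (B⊆ here))
  IsGF2Rank-inside-∉span {A} {k} ((outside ∷ B , B⊆ , indB , ∣B∣≡k) , maxk) c₀∉span =
    (inside ∷ B , in⊆in (drop-∷-⊆ B⊆) , LinIndep-inside⁺ indB c₀∉span′ , cong suc ∣B∣≡k) , maximal
    where
    c₀∉span′ : ¬ InSpan (c ∘ fsuc) B (c fzero)
    c₀∉span′ = c₀∉span ∘ InSpan-⊆ (c ∘ fsuc) (drop-∷-⊆ B⊆)
    maximal : ∀ B′ → B′ ⊆ inside ∷ A → LinIndep c B′ → ∣ B′ ∣ ≤ suc k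
    maximal (b ∷ B′) B′⊆ indB′ = ≤-trans (∣x∷p∣≤1+∣p∣ b B′)
      (s≤s (maxk (outside ∷ B′) (out⊆ (drop-∷-⊆ B′⊆)) (LinIndep-⊆ c indB′ (out⊆ ⊆-refl))))

  -- If fzero lies in the span of A, a basis of inside ∷ A through fzero can
  -- trade fzero for some element of A.
  IsGF2Rank-inside-∈span : ∀ {A k} → IsGF2Rank c (outside ∷ A) k →
    InSpan (c ∘ fsuc) A (c fzero) → IsGF2Rank c (inside ∷ A) k
  IsGF2Rank-inside-∈span ((inside ∷ B , B⊆ , _) , _) _ = ⊥-elim (fzero∉outside (B⊆ here))
  IsGF2Rank-inside-∈span {A} {k} ((outside ∷ B , B⊆ , indB , ∣B∣≡k) , maxk) c₀∈span =
    (outside ∷ B , out⊆ (drop-∷-⊆ B⊆) , indB , ∣B∣≡k) , maximal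
    where
    maximal : ∀ B′ → B′ ⊆ inside ∷ A → LinIndep c B′ → ∣ B′ ∣ ≤ k
    maximal (outside ∷ B′) B′⊆ indB′ = maxk (outside ∷ B′) (out⊆ (drop-∷-⊆ B′⊆)) indB′
    maximal (inside  ∷ B′) B′⊆ indB′
      with ∃column∉span (c ∘ fsuc) c₀∈span (LinIndep-inside⇒∉span indB′)
    ... | i , i∈A , i∉span = subst (_≤ k) (∣⊕⁅⁆∣ i B′ (∉span⇒∉ (c ∘ fsuc) i∉span))
      (maxk (outside ∷ (B′ ⊕V ⁅ i ⁆)) (out⊆ (⊕⁅⁆-⊆ (drop-∷-⊆ B′⊆) i∈A))
        (LinIndep-outside⁺ (LinIndep-⊕⁅⁆ (c ∘ fsuc) indB″ i∉span)))
      where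
      indB″ : LinIndep (c ∘ fsuc) B′
      indB″ = LinIndep-outside⁻ (LinIndep-⊆ c indB′ (out⊆ ⊆-refl))

-- Cycles of a delta-sum

module _ {n₁ n₂ m₁ m₂ m : ℕ} (M₁ : Matroid (suc n₁)) (M₂ : Matroid (suc n₂)) (M : Matroid (n₁ +ℕ n₂))
  {c₁ : Fin (suc n₁) → Vec Bool m₁} {c₂ : Fin (suc n₂) → Vec Bool m₂} {cM : Fin (n₁ +ℕ n₂) → Vec Bool m}
  (rep₁ : ∀ A → IsGF2Rank c₁ A (rank M₁ A)) (rep₂ : ∀ A → IsGF2Rank c₂ A (rank M₂ A))
  (repM : ∀ A → IsGF2Rank cM A (rank M A)) (Δ : IsDeltaSum M₁ M₂ M) where

  deltaSum-kernel⁻ : ∀ S₁ S₂ → Kernel cM (S₁ ++ S₂) → ∃[ b ] Kernel c₁ (b ∷ S₁) × Kernel c₂ (b ∷ S₂)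
  deltaSum-kernel⁻ S₁ S₂ ker with proj₁ (proj₂ Δ (S₁ ++ S₂)) (kernel⇒cycle M repM ker)
  ... | b ∷ T₁ , _ ∷ T₂ , cyc₁ , cyc₂ , refl , S₁++S₂≡T₁++T₂
    rewrite ++-injectiveˡ S₁ T₁ S₁++S₂≡T₁++T₂ | ++-injectiveʳ S₁ T₁ S₁++S₂≡T₁++T₂ =
    b , cycle⇒kernel M₁ rep₁ cyc₁ , cycle⇒kernel M₂ rep₂ cyc₂

  deltaSum-kernel⁺ : ∀ S₁ S₂ b → Kernel c₁ (b ∷ S₁) → Kernel c₂ (b ∷ S₂) → Kernel cM (S₁ ++ S₂)
  deltaSum-kernel⁺ S₁ S₂ b ker₁ ker₂ = cycle⇒kernel M repM (proj₂ (proj₂ Δ (S₁ ++ S₂))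
    (b ∷ S₁ , b ∷ S₂ , kernel⇒cycle M₁ rep₁ ker₁ , kernel⇒cycle M₂ rep₂ ker₂ , refl , refl))

-- Subset sums in a commutative ring

module _ {a ℓ} (R : CommutativeRing a ℓ) where

  open CommutativeRing R renaming (refl to ≈-refl; sym to ≈-sym; trans to ≈-trans)
  open import Algebra.Solver.Ring.NaturalCoefficients.Default commutativeSemiring
  open import Relation.Binary.Reasoning.Setoid setoid

  indicator : ∀ {p} {P : Set p} → Dec P → Carrier
  indicator (yes _) = 1#
  indicator (no _)  = 0#

  module _ {p} {P : Set p} where

    indicator-yes : (P? : Dec P) → P → indicator P? ≈ 1#
    indicator-yes (yes _) _ = ≈-refl
    indicator-yes (no ¬p) p = contradiction p ¬p

    indicator-no : (P? : Dec P) → ¬ P → indicator P? ≈ 0#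
    indicator-no (yes p) ¬p = contradiction p ¬p
    indicator-no (no _)  _  = ≈-refl

  module _ {p q} {P : Set p} {Q : Set q} where

    indicator-cong : (P? : Dec P) (Q? : Dec Q) → (P → Q) → (Q → P) → indicator P? ≈ indicator Q?
    indicator-cong (yes _) (yes _) _   _   = ≈-refl
    indicator-cong (no  _) (no  _) _   _   = ≈-refl
    indicator-cong (yes p) (no ¬q) P⇒Q _   = contradiction (P⇒Q p) ¬q
    indicator-cong (no ¬p) (yes q) _   Q⇒P = contradiction (Q⇒P q) ¬p

    indicator-× : (P? : Dec P) (Q? : Dec Q) → indicator (P? ×-dec Q?) ≈ indicator P? * indicator Q?
    indicator-× (yes _) (yes _) = ≈-sym (*-identityˡ 1#)
    indicator-× (yes _) (no  _) = ≈-sym (zeroʳ 1#)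
    indicator-× (no  _) _       = ≈-sym (zeroˡ _)

    indicator-⊎ : (P? : Dec P) (Q? : Dec Q) → ¬ (P × Q) →
      indicator (P? ⊎-dec Q?) ≈ indicator P? + indicator Q?
    indicator-⊎ (yes p) (yes q) ¬P×Q = contradiction (p , q) ¬P×Q
    indicator-⊎ (yes _) (no  _) _    = ≈-sym (+-identityʳ 1#)
    indicator-⊎ (no  _) (yes _) _    = ≈-sym (+-identityˡ 1#)
    indicator-⊎ (no  _) (no  _) _    = ≈-sym (+-identityˡ 0#)

  χ : (Fin n → Vec Bool m) → Subset n → Carrier
  χ c S = indicator (kernel? c S)

  χ-cong : (c : Fin n → Vec Bool m) (d : Fin n′ → Vec Bool m) (S : Subset n) (T : Subset n′) →
    colSum c S ≡ colSum d T → χ c S ≈ χ d T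
  χ-cong c d S T eq = indicator-cong (kernel? c S) (kernel? d T) (trans (sym eq)) (trans eq)

  ζ : (Subset n → Carrier) → Subset n → Carrier
  ζ φ []            = φ []
  ζ φ (outside ∷ A) = ζ (φ ∘ (outside ∷_)) A
  ζ φ (inside  ∷ A) = ζ (φ ∘ (outside ∷_)) A + ζ (φ ∘ (inside ∷_)) A

  ζ-cong : {φ ψ : Subset n → Carrier} → (∀ S → φ S ≈ ψ S) → ∀ A → ζ φ A ≈ ζ ψ A
  ζ-cong φ≈ψ []            = φ≈ψ []
  ζ-cong φ≈ψ (outside ∷ A) = ζ-cong (φ≈ψ ∘ (outside ∷_)) A
  ζ-cong φ≈ψ (inside  ∷ A) = +-cong (ζ-cong (φ≈ψ ∘ (outside ∷_)) A) (ζ-cong (φ≈ψ ∘ (inside ∷_)) A)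

  ζ-+ : (φ ψ : Subset n → Carrier) → ∀ A → ζ (λ S → φ S + ψ S) A ≈ ζ φ A + ζ ψ A
  ζ-+ φ ψ []            = ≈-refl
  ζ-+ φ ψ (outside ∷ A) = ζ-+ (φ ∘ (outside ∷_)) (ψ ∘ (outside ∷_)) A
  ζ-+ φ ψ (inside  ∷ A) = ≈-trans
    (+-cong (ζ-+ (φ ∘ (outside ∷_)) (ψ ∘ (outside ∷_)) A) (ζ-+ (φ ∘ (inside ∷_)) (ψ ∘ (inside ∷_)) A))
    (solve 4 (λ a b x y → (a :+ b) :+ (x :+ y) := (a :+ x) :+ (b :+ y)) ≈-refl _ _ _ _)

  ζ-vanish : {φ : Subset n → Carrier} (A : Subset n) → (∀ {S} → S ⊆ A → φ S ≈ 0#) → ζ φ A ≈ 0#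
  ζ-vanish []            φ≈0 = φ≈0 ⊆-refl
  ζ-vanish (outside ∷ A) φ≈0 = ζ-vanish A (φ≈0 ∘ out⊆)
  ζ-vanish (inside  ∷ A) φ≈0 =
    ≈-trans (+-cong (ζ-vanish A (φ≈0 ∘ out⊆)) (ζ-vanish A (φ≈0 ∘ in⊆in))) (+-identityʳ 0#)

  ζ-translate : (φ : Subset n → Carrier) {A S₀ : Subset n} → S₀ ⊆ A → ζ (λ S → φ (S ⊕V S₀)) A ≈ ζ φ A
  ζ-translate φ {[]}          {[]}           _    = ≈-refl
  ζ-translate φ {outside ∷ A} {outside ∷ S₀} S₀⊆A = ζ-translate (φ ∘ (outside ∷_)) (drop-∷-⊆ S₀⊆A)
  ζ-translate φ {outside ∷ A} {inside  ∷ S₀} S₀⊆A = ⊥-elim (fzero∉outside (S₀⊆A here))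
  ζ-translate φ {inside  ∷ A} {outside ∷ S₀} S₀⊆A =
    +-cong (ζ-translate (φ ∘ (outside ∷_)) (drop-∷-⊆ S₀⊆A))
           (ζ-translate (φ ∘ (inside ∷_)) (drop-∷-⊆ S₀⊆A))
  ζ-translate φ {inside  ∷ A} {inside  ∷ S₀} S₀⊆A = ≈-trans (+-comm _ _)
    (+-cong (ζ-translate (φ ∘ (outside ∷_)) (drop-∷-⊆ S₀⊆A))
            (ζ-translate (φ ∘ (inside ∷_)) (drop-∷-⊆ S₀⊆A)))

  sumSubsets-cong : {f g : Subset n → Carrier} → (∀ A → f A ≈ g A) → sumSubsets R f ≈ sumSubsets R g
  sumSubsets-cong {zero}  f≈g = f≈g []
  sumSubsets-cong {suc n} f≈g =
    +-cong (sumSubsets-cong (f≈g ∘ (outside ∷_))) (sumSubsets-cong (f≈g ∘ (inside ∷_)))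

  sumSubsets-+ : (f g : Subset n → Carrier) →
    sumSubsets R (λ A → f A + g A) ≈ sumSubsets R f + sumSubsets R g
  sumSubsets-+ {zero}  f g = ≈-refl
  sumSubsets-+ {suc n} f g = ≈-trans
    (+-cong (sumSubsets-+ (f ∘ (outside ∷_)) (g ∘ (outside ∷_)))
            (sumSubsets-+ (f ∘ (inside ∷_)) (g ∘ (inside ∷_))))
    (solve 4 (λ a b x y → (a :+ b) :+ (x :+ y) := (a :+ x) :+ (b :+ y)) ≈-refl _ _ _ _)

  sumSubsets-*ˡ : (k : Carrier) (f : Subset n → Carrier) →
    sumSubsets R (λ A → k * f A) ≈ k * sumSubsets R f
  sumSubsets-*ˡ {zero}  k f = ≈-refl
  sumSubsets-*ˡ {suc n} k f = ≈-trans
    (+-cong (sumSubsets-*ˡ k (f ∘ (outside ∷_))) (sumSubsets-*ˡ k (f ∘ (inside ∷_))))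
    (≈-sym (distribˡ k _ _))

  -- Ψ w φ = Σ_S φ S ∏_{i ∈ S} w i ∏_{i ∉ S} (1 + w i)
  Ψ : (Fin n → Carrier) → (Subset n → Carrier) → Carrier
  Ψ {zero}  w φ = φ []
  Ψ {suc n} w φ =
    (1# + w fzero) * Ψ (w ∘ fsuc) (φ ∘ (outside ∷_)) + w fzero * Ψ (w ∘ fsuc) (φ ∘ (inside ∷_))

  Ψ-cong : {w w′ : Fin n → Carrier} {φ ψ : Subset n → Carrier} →
    (∀ i → w i ≈ w′ i) → (∀ S → φ S ≈ ψ S) → Ψ w φ ≈ Ψ w′ ψ
  Ψ-cong {zero}  w≈w′ φ≈ψ = φ≈ψ []
  Ψ-cong {suc n} w≈w′ φ≈ψ =
    +-cong (*-cong (+-cong ≈-refl (w≈w′ fzero)) (Ψ-cong (w≈w′ ∘ fsuc) (φ≈ψ ∘ (outside ∷_))))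
           (*-cong (w≈w′ fzero) (Ψ-cong (w≈w′ ∘ fsuc) (φ≈ψ ∘ (inside ∷_))))

  Ψ-+ : (w : Fin n → Carrier) (φ ψ : Subset n → Carrier) → Ψ w (λ S → φ S + ψ S) ≈ Ψ w φ + Ψ w ψ
  Ψ-+ {zero}  w φ ψ = ≈-refl
  Ψ-+ {suc n} w φ ψ = ≈-trans
    (+-cong (*-cong ≈-refl (Ψ-+ (w ∘ fsuc) (φ ∘ (outside ∷_)) (ψ ∘ (outside ∷_))))
            (*-cong ≈-refl (Ψ-+ (w ∘ fsuc) (φ ∘ (inside ∷_)) (ψ ∘ (inside ∷_)))))
    (solve 5 (λ a x y u v → (con 1 :+ a) :* (x :+ y) :+ a :* (u :+ v)
                         := ((con 1 :+ a) :* x :+ a :* u) :+ ((con 1 :+ a) :* y :+ a :* v))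
       ≈-refl _ _ _ _ _)

  Ψ-*ˡ : (w : Fin n → Carrier) (k : Carrier) (φ : Subset n → Carrier) → Ψ w (λ S → k * φ S) ≈ k * Ψ w φ
  Ψ-*ˡ {zero}  w k φ = ≈-refl
  Ψ-*ˡ {suc n} w k φ = ≈-trans
    (+-cong (*-cong ≈-refl (Ψ-*ˡ (w ∘ fsuc) k (φ ∘ (outside ∷_))))
            (*-cong ≈-refl (Ψ-*ˡ (w ∘ fsuc) k (φ ∘ (inside ∷_)))))
    (solve 4 (λ a k x u → (con 1 :+ a) :* (k :* x) :+ a :* (k :* u)
                       := k :* ((con 1 :+ a) :* x :+ a :* u))
       ≈-refl _ _ _ _)

  Ψ-*ʳ : (w : Fin n → Carrier) (φ : Subset n → Carrier) (k : Carrier) → Ψ w (λ S → φ S * k) ≈ Ψ w φ * k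
  Ψ-*ʳ w φ k = ≈-trans (Ψ-cong (λ _ → ≈-refl) (λ S → *-comm (φ S) k)) (≈-trans (Ψ-*ˡ w k φ) (*-comm k _))

  Ψ-++ : ∀ n₁ {n₂} (w₁ : Fin n₁ → Carrier) (w₂ : Fin n₂ → Carrier) (φ : Subset (n₁ +ℕ n₂) → Carrier) →
    Ψ ([ w₁ , w₂ ] ∘ splitAt n₁) φ ≈ Ψ w₁ (λ S₁ → Ψ w₂ (λ S₂ → φ (S₁ ++ S₂)))
  Ψ-++ zero     w₁ w₂ φ = ≈-refl
  Ψ-++ (suc n₁) w₁ w₂ φ = +-cong (*-cong ≈-refl (step (outside ∷_))) (*-cong ≈-refl (step (inside ∷_)))
    where
    step : (ext : Subset (n₁ +ℕ _) → Subset (suc n₁ +ℕ _)) →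
      Ψ (λ i → [ w₁ , w₂ ] (splitAt (suc n₁) (fsuc i))) (φ ∘ ext)
      ≈ Ψ (w₁ ∘ fsuc) (λ S₁ → Ψ w₂ (λ S₂ → φ (ext (S₁ ++ S₂))))
    step ext = ≈-trans (Ψ-cong (λ i → reflexive ([,]-map (splitAt n₁ i))) (λ _ → ≈-refl))
                       (Ψ-++ n₁ (w₁ ∘ fsuc) w₂ (φ ∘ ext))

  Ψ-separable : ∀ {n₁ n₂} (w₁ : Fin n₁ → Carrier) (w₂ : Fin n₂ → Carrier)
    (f : Subset n₁ → Carrier) (g : Subset n₂ → Carrier) →
    Ψ w₁ (λ S₁ → Ψ w₂ (λ S₂ → f S₁ * g S₂)) ≈ Ψ w₁ f * Ψ w₂ g
  Ψ-separable w₁ w₂ f g = ≈-trans (Ψ-cong (λ _ → ≈-refl) (λ S₁ → Ψ-*ˡ w₂ (f S₁) g)) (Ψ-*ʳ w₁ f (Ψ w₂ g))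

  Ψ-bilinear : ∀ {n₁ n₂} (w₁ : Fin n₁ → Carrier) (w₂ : Fin n₂ → Carrier)
    (f : Subset n₁ → Carrier) (g : Subset n₂ → Carrier)
    (f′ : Subset n₁ → Carrier) (g′ : Subset n₂ → Carrier) →
    Ψ w₁ (λ S₁ → Ψ w₂ (λ S₂ → f S₁ * g S₂ + f′ S₁ * g′ S₂)) ≈ Ψ w₁ f * Ψ w₂ g + Ψ w₁ f′ * Ψ w₂ g′
  Ψ-bilinear w₁ w₂ f g f′ g′ = begin
    Ψ w₁ (λ S₁ → Ψ w₂ (λ S₂ → f S₁ * g S₂ + f′ S₁ * g′ S₂))
      ≈⟨ Ψ-cong (λ _ → ≈-refl) (λ S₁ → Ψ-+ w₂ (λ S₂ → f S₁ * g S₂) (λ S₂ → f′ S₁ * g′ S₂)) ⟩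
    Ψ w₁ (λ S₁ → Ψ w₂ (λ S₂ → f S₁ * g S₂) + Ψ w₂ (λ S₂ → f′ S₁ * g′ S₂))
      ≈⟨ Ψ-+ w₁ (λ S₁ → Ψ w₂ (λ S₂ → f S₁ * g S₂)) (λ S₁ → Ψ w₂ (λ S₂ → f′ S₁ * g′ S₂)) ⟩
    Ψ w₁ (λ S₁ → Ψ w₂ (λ S₂ → f S₁ * g S₂)) + Ψ w₁ (λ S₁ → Ψ w₂ (λ S₂ → f′ S₁ * g′ S₂))
      ≈⟨ +-cong (Ψ-separable w₁ w₂ f g) (Ψ-separable w₁ w₂ f′ g′) ⟩
    Ψ w₁ f * Ψ w₂ g + Ψ w₁ f′ * Ψ w₂ g′ ∎

  sumSubsets-ζ≈Ψ : (h : Carrier) (γ : Fin n → Carrier) (φ : Subset n → Carrier) →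
    sumSubsets R (λ A → weightProd R γ A * (pow R h ∣ A ∣ * ζ φ A)) ≈ Ψ (λ i → γ i * h) φ
  sumSubsets-ζ≈Ψ {zero}  h γ φ = ≈-trans (*-identityˡ _) (*-identityˡ (φ []))
  sumSubsets-ζ≈Ψ {suc n} h γ φ = begin
    sumSubsets R (T φₒ) + sumSubsets R (λ A → (γ fzero * weightProd R (γ ∘ fsuc) A) *
                                               ((h * pow R h ∣ A ∣) * (ζ φₒ A + ζ φᵢ A)))
      ≈⟨ +-cong (sumSubsets-ζ≈Ψ h (γ ∘ fsuc) φₒ) (sumSubsets-cong regroup) ⟩
    Ψ w′ φₒ + sumSubsets R (λ A → (γ fzero * h) * (T φₒ A + T φᵢ A))
      ≈⟨ +-cong ≈-refl (sumSubsets-*ˡ (γ fzero * h) (λ A → T φₒ A + T φᵢ A)) ⟩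
    Ψ w′ φₒ + (γ fzero * h) * sumSubsets R (λ A → T φₒ A + T φᵢ A)
      ≈⟨ +-cong ≈-refl (*-cong ≈-refl (≈-trans (sumSubsets-+ (T φₒ) (T φᵢ))
           (+-cong (sumSubsets-ζ≈Ψ h (γ ∘ fsuc) φₒ) (sumSubsets-ζ≈Ψ h (γ ∘ fsuc) φᵢ)))) ⟩
    Ψ w′ φₒ + (γ fzero * h) * (Ψ w′ φₒ + Ψ w′ φᵢ)
      ≈⟨ solve 3 (λ a x y → x :+ a :* (x :+ y) := (con 1 :+ a) :* x :+ a :* y) ≈-refl _ _ _ ⟩
    (1# + γ fzero * h) * Ψ w′ φₒ + (γ fzero * h) * Ψ w′ φᵢ ∎
    where
    φₒ φᵢ : Subset n → Carrier
    φₒ = φ ∘ (outside ∷_)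
    φᵢ = φ ∘ (inside ∷_)
    w′ : Fin n → Carrier
    w′ i = γ (fsuc i) * h
    T : (Subset n → Carrier) → Subset n → Carrier
    T ψ A = weightProd R (γ ∘ fsuc) A * (pow R h ∣ A ∣ * ζ ψ A)
    regroup : ∀ A → (γ fzero * weightProd R (γ ∘ fsuc) A) * ((h * pow R h ∣ A ∣) * (ζ φₒ A + ζ φᵢ A))
                    ≈ (γ fzero * h) * (T φₒ A + T φᵢ A)
    regroup A = solve 6 (λ g w h p x y → (g :* w) :* ((h :* p) :* (x :+ y))
                                       := (g :* h) :* (w :* (p :* x) :+ w :* (p :* y)))
                  ≈-refl _ _ _ _ _ _

  -- With -1 read as an indeterminate n, the two sides differ by (n + 1) (2 a₁ a₂ + a₁ b₂ + b₁ a₂).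
  matrix-identity : ∀ a₁ b₁ a₂ b₂ →
    a₁ * ((1# + 1#) * a₂ + (- 1#) * (a₂ + b₂)) + (a₁ + b₁) * ((- 1#) * a₂ + 1# * (a₂ + b₂))
    ≈ a₁ * a₂ + b₁ * b₂
  matrix-identity a₁ b₁ a₂ b₂ = begin
    a₁ * ((1# + 1#) * a₂ + (- 1#) * (a₂ + b₂)) + (a₁ + b₁) * ((- 1#) * a₂ + 1# * (a₂ + b₂))
      ≈⟨ solve 5 (λ a₁ b₁ a₂ b₂ n →
           a₁ :* ((con 1 :+ con 1) :* a₂ :+ n :* (a₂ :+ b₂))
             :+ (a₁ :+ b₁) :* (n :* a₂ :+ con 1 :* (a₂ :+ b₂))
           := (a₁ :* a₂ :+ b₁ :* b₂)
             :+ (n :+ con 1) :* ((con 1 :+ con 1) :* (a₁ :* a₂) :+ a₁ :* b₂ :+ b₁ :* a₂))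
           ≈-refl a₁ b₁ a₂ b₂ (- 1#) ⟩
    (a₁ * a₂ + b₁ * b₂) + (- 1# + 1#) * ((1# + 1#) * (a₁ * a₂) + a₁ * b₂ + b₁ * a₂)
      ≈⟨ +-cong ≈-refl (≈-trans (*-cong (-‿inverseˡ 1#) ≈-refl) (zeroˡ _)) ⟩
    (a₁ * a₂ + b₁ * b₂) + 0#
      ≈⟨ +-identityʳ _ ⟩
    a₁ * a₂ + b₁ * b₂ ∎

  module _ (half : Carrier) (half+half≈1 : half + half ≈ 1#) where

    private
      h^ : ℕ → Carrier
      h^ = pow R half

    x≈half*x+half*x : ∀ x → x ≈ half * x + half * x
    x≈half*x+half*x x = begin
      x                    ≈⟨ ≈-sym (*-identityˡ x) ⟩
      1# * x               ≈⟨ *-cong (≈-sym half+half≈1) ≈-refl ⟩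
      (half + half) * x    ≈⟨ distribʳ x half half ⟩
      half * x + half * x  ∎

    half-cancelˡ : ∀ {x y} → half * x ≈ half * y → x ≈ y
    half-cancelˡ {x} {y} hx≈hy = begin
      x                    ≈⟨ x≈half*x+half*x x ⟩
      half * x + half * x  ≈⟨ +-cong hx≈hy hx≈hy ⟩
      half * y + half * y  ≈⟨ ≈-sym (x≈half*x+half*x y) ⟩
      y                    ∎

    h^-pred : ∀ k {y} → 1 ≤ k → h^ k ≈ half * y → h^ (k ∸ℕ 1) ≈ y
    h^-pred (suc k) _ = half-cancelˡ

    rank-nullity : (c : Fin n → Vec Bool m) (r : Subset n → ℕ) → (∀ A → IsGF2Rank c A (r A)) →
      ∀ A → h^ (r A) ≈ h^ ∣ A ∣ * ζ (χ c) A
    rank-nullity {zero}  c r rep [] rewrite IsGF2Rank-[] c (rep []) =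
      ≈-sym (≈-trans (*-identityˡ _) (indicator-yes (kernel? c []) refl))
    rank-nullity {suc n} c r rep = step
      where
      χₒ χᵢ : Subset n → Carrier
      χₒ = χ c ∘ (outside ∷_)
      χᵢ = χ c ∘ (inside ∷_)

      outside-step : ∀ A → h^ (r (outside ∷ A)) ≈ h^ ∣ A ∣ * ζ χₒ A
      outside-step A = ≈-trans
        (rank-nullity (c ∘ fsuc) (r ∘ (outside ∷_)) (IsGF2Rank-outside c ∘ rep ∘ (outside ∷_)) A)
        (*-cong ≈-refl (ζ-cong (λ S → χ-cong (c ∘ fsuc) c S (outside ∷ S) (sym (colSum-outside c S))) A))

      step : ∀ A → h^ (r A) ≈ h^ ∣ A ∣ * ζ (χ c) A
      step (outside ∷ A) = outside-step A
      step (inside  ∷ A) with inSpan? (c ∘ fsuc) A (c fzero)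
      ... | yes c₀∈span@(S₀ , S₀⊆A , colSum≡c₀) = begin
        h^ (r (inside ∷ A))                     ≡⟨ cong h^ r≡ ⟩
        h^ (r (outside ∷ A))                    ≈⟨ outside-step A ⟩
        h^ ∣ A ∣ * ζ χₒ A                       ≈⟨ *-cong ≈-refl (x≈half*x+half*x _) ⟩
        h^ ∣ A ∣ * (half * ζ χₒ A + half * ζ χₒ A)
          ≈⟨ solve 3 (λ p h x → p :* (h :* x :+ h :* x) := (h :* p) :* (x :+ x)) ≈-refl _ _ _ ⟩
        (half * h^ ∣ A ∣) * (ζ χₒ A + ζ χₒ A)   ≈⟨ *-cong ≈-refl (+-cong ≈-refl (≈-sym ζχᵢ≈ζχₒ)) ⟩
        (half * h^ ∣ A ∣) * (ζ χₒ A + ζ χᵢ A)   ∎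
        where
        r≡ : r (inside ∷ A) ≡ r (outside ∷ A)
        r≡ = IsGF2Rank-unique c (rep (inside ∷ A)) (IsGF2Rank-inside-∈span c (rep (outside ∷ A)) c₀∈span)
        ζχᵢ≈ζχₒ : ζ χᵢ A ≈ ζ χₒ A
        ζχᵢ≈ζχₒ = ≈-trans (ζ-cong χᵢ≈translate A) (ζ-translate χₒ S₀⊆A)
          where
          χᵢ≈translate : ∀ S → χᵢ S ≈ χₒ (S ⊕V S₀)
          χᵢ≈translate S = χ-cong c c (inside ∷ S) (outside ∷ (S ⊕V S₀)) (colSum-inside-translate c colSum≡c₀ S)
      ... | no c₀∉span = begin
        h^ (r (inside ∷ A))                     ≡⟨ cong h^ r≡ ⟩
        half * h^ (r (outside ∷ A))             ≈⟨ *-cong ≈-refl (outside-step A) ⟩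
        half * (h^ ∣ A ∣ * ζ χₒ A)
          ≈⟨ solve 3 (λ h p x → h :* (p :* x) := (h :* p) :* (x :+ con 0)) ≈-refl _ _ _ ⟩
        (half * h^ ∣ A ∣) * (ζ χₒ A + 0#)       ≈⟨ *-cong ≈-refl (+-cong ≈-refl (≈-sym ζχᵢ≈0)) ⟩
        (half * h^ ∣ A ∣) * (ζ χₒ A + ζ χᵢ A)   ∎
        where
        r≡ : r (inside ∷ A) ≡ suc (r (outside ∷ A))
        r≡ = IsGF2Rank-unique c (rep (inside ∷ A)) (IsGF2Rank-inside-∉span c (rep (outside ∷ A)) c₀∉span)
        ζχᵢ≈0 : ζ χᵢ A ≈ 0#
        ζχᵢ≈0 = ζ-vanish A λ {S} S⊆A → indicator-no (kernel? c (inside ∷ S))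
          λ ker → c₀∉span (S , S⊆A , kernel-inside⇒colSum c ker)

    Ztilde≈Ψ : (r : Subset n → ℕ) (φ : Subset n → Carrier) → (∀ A → h^ (r A) ≈ h^ ∣ A ∣ * ζ φ A) →
      (γ : Fin n → Carrier) → Ztilde R half r γ ≈ Ψ (λ i → γ i * half) φ
    Ztilde≈Ψ r φ r≈ζ γ =
      ≈-trans (sumSubsets-cong (λ A → *-cong ≈-refl (r≈ζ A))) (sumSubsets-ζ≈Ψ half γ φ)

    module _ (N : Matroid (suc n)) {c : Fin (suc n) → Vec Bool m} (rep : ∀ A → IsGF2Rank c A (rank N A))
      (γ : Fin n → Carrier) where

      private
        w : Fin n → Carrier
        w i = γ i * half
        χₒ χᵢ : Subset n → Carrier
        χₒ = χ c ∘ (outside ∷_)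
        χᵢ = χ c ∘ (inside ∷_)

      Ztilde-delete : Ztilde R half (deleteRank N) γ ≈ Ψ w χₒ
      Ztilde-delete = Ztilde≈Ψ (deleteRank N) χₒ (rank-nullity c (rank N) rep ∘ (outside ∷_)) γ

      Ztilde-contract : ¬ IsLoop N fzero → Ztilde R half (contractRank N) γ ≈ Ψ w χₒ + Ψ w χᵢ
      Ztilde-contract ¬loop = ≈-trans (Ztilde≈Ψ (contractRank N) _ contract-nullity γ) (Ψ-+ w χₒ χᵢ)
        where
        rank⁅p⁆≡1 : rank N (inside ∷ ⊥) ≡ 1
        rank⁅p⁆≡1 = ¬loop⇒rank⁅⁆≡1 N fzero ¬loop
        contract-nullity : ∀ A → h^ (contractRank N A) ≈ h^ ∣ A ∣ * ζ (λ S → χₒ S + χᵢ S) A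
        contract-nullity A = begin
          h^ (rank N (inside ∷ A) ∸ℕ rank N (inside ∷ ⊥))  ≡⟨ cong (λ k → h^ (rank N (inside ∷ A) ∸ℕ k)) rank⁅p⁆≡1 ⟩
          h^ (rank N (inside ∷ A) ∸ℕ 1)                    ≈⟨ h^-pred _ 1≤rank rank-nullity-inside ⟩
          h^ ∣ A ∣ * (ζ χₒ A + ζ χᵢ A)                      ≈⟨ *-cong ≈-refl (≈-sym (ζ-+ χₒ χᵢ A)) ⟩
          h^ ∣ A ∣ * ζ (λ S → χₒ S + χᵢ S) A               ∎
          where
          1≤rank : 1 ≤ rank N (inside ∷ A)
          1≤rank = subst (_≤ rank N (inside ∷ A)) rank⁅p⁆≡1 (rank-mono N _ _ (in⊆in ⊥⊆))
          rank-nullity-inside : h^ (rank N (inside ∷ A)) ≈ half * (h^ ∣ A ∣ * (ζ χₒ A + ζ χᵢ A))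
          rank-nullity-inside = ≈-trans (rank-nullity c (rank N) rep (inside ∷ A)) (*-assoc _ _ _)

    module _ {n₁ n₂ m₁ m₂ m} (M₁ : Matroid (suc n₁)) (M₂ : Matroid (suc n₂)) (M : Matroid (n₁ +ℕ n₂))
      {c₁ : Fin (suc n₁) → Vec Bool m₁} {c₂ : Fin (suc n₂) → Vec Bool m₂} {cM : Fin (n₁ +ℕ n₂) → Vec Bool m}
      (rep₁ : ∀ A → IsGF2Rank c₁ A (rank M₁ A)) (rep₂ : ∀ A → IsGF2Rank c₂ A (rank M₂ A))
      (repM : ∀ A → IsGF2Rank cM A (rank M A)) (Δ : IsDeltaSum M₁ M₂ M) (¬loop₁ : ¬ IsLoop M₁ fzero)
      where

      private
        a₁ b₁ : Subset n₁ → Carrier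
        a₁ = χ c₁ ∘ (outside ∷_)
        b₁ = χ c₁ ∘ (inside ∷_)
        a₂ b₂ : Subset n₂ → Carrier
        a₂ = χ c₂ ∘ (outside ∷_)
        b₂ = χ c₂ ∘ (inside ∷_)

      χ-deltaSum : ∀ S₁ S₂ → χ cM (S₁ ++ S₂) ≈ a₁ S₁ * a₂ S₂ + b₁ S₁ * b₂ S₂
      χ-deltaSum S₁ S₂ = begin
        χ cM (S₁ ++ S₂)                ≈⟨ indicator-cong (kernel? cM (S₁ ++ S₂)) (Kₒ? ⊎-dec Kᵢ?) to from ⟩
        indicator (Kₒ? ⊎-dec Kᵢ?)      ≈⟨ indicator-⊎ Kₒ? Kᵢ? exclusive ⟩
        indicator Kₒ? + indicator Kᵢ?  ≈⟨ +-cong (indicator-× Pₒ? Qₒ?) (indicator-× Pᵢ? Qᵢ?) ⟩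
        a₁ S₁ * a₂ S₂ + b₁ S₁ * b₂ S₂  ∎
        where
        Kₒ Kᵢ : Set
        Kₒ = Kernel c₁ (outside ∷ S₁) × Kernel c₂ (outside ∷ S₂)
        Kᵢ = Kernel c₁ (inside ∷ S₁) × Kernel c₂ (inside ∷ S₂)
        Pₒ? = kernel? c₁ (outside ∷ S₁)
        Qₒ? = kernel? c₂ (outside ∷ S₂)
        Pᵢ? = kernel? c₁ (inside ∷ S₁)
        Qᵢ? = kernel? c₂ (inside ∷ S₂)
        Kₒ? : Dec Kₒ
        Kₒ? = Pₒ? ×-dec Qₒ?
        Kᵢ? : Dec Kᵢ
        Kᵢ? = Pᵢ? ×-dec Qᵢ?
        to : Kernel cM (S₁ ++ S₂) → Kₒ ⊎ Kᵢ
        to ker with deltaSum-kernel⁻ M₁ M₂ M rep₁ rep₂ repM Δ S₁ S₂ ker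
        ... | outside , kers = inj₁ kers
        ... | inside  , kers = inj₂ kers
        from : Kₒ ⊎ Kᵢ → Kernel cM (S₁ ++ S₂)
        from (inj₁ (ker₁ , ker₂)) = deltaSum-kernel⁺ M₁ M₂ M rep₁ rep₂ repM Δ S₁ S₂ outside ker₁ ker₂
        from (inj₂ (ker₁ , ker₂)) = deltaSum-kernel⁺ M₁ M₂ M rep₁ rep₂ repM Δ S₁ S₂ inside  ker₁ ker₂
        exclusive : ¬ (Kₒ × Kᵢ)
        exclusive ((kerₒ , _) , (kerᵢ , _)) = kernel-outside⇒¬kernel-inside M₁ rep₁ ¬loop₁ kerₒ kerᵢ

      Ztilde-deltaSum : (γ₁ : Fin (suc n₁) → Carrier) (γ₂ : Fin (suc n₂) → Carrier) →
        let w₁ = λ i → γ₁ (fsuc i) * half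
            w₂ = λ i → γ₂ (fsuc i) * half
        in Ztilde R half (rank M) (λ i → [ γ₁ ∘ fsuc , γ₂ ∘ fsuc ] (splitAt n₁ i))
           ≈ Ψ w₁ a₁ * Ψ w₂ a₂ + Ψ w₁ b₁ * Ψ w₂ b₂
      Ztilde-deltaSum γ₁ γ₂ = begin
        Ztilde R half (rank M) γ
          ≈⟨ Ztilde≈Ψ (rank M) (χ cM) (rank-nullity cM (rank M) repM) γ ⟩
        Ψ (λ i → γ i * half) (χ cM)
          ≈⟨ Ψ-cong split-weights (λ _ → ≈-refl) ⟩
        Ψ ([ w₁ , w₂ ] ∘ splitAt n₁) (χ cM)
          ≈⟨ Ψ-++ n₁ w₁ w₂ (χ cM) ⟩
        Ψ w₁ (λ S₁ → Ψ w₂ (λ S₂ → χ cM (S₁ ++ S₂)))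
          ≈⟨ Ψ-cong (λ _ → ≈-refl) (λ S₁ → Ψ-cong (λ _ → ≈-refl) (χ-deltaSum S₁)) ⟩
        Ψ w₁ (λ S₁ → Ψ w₂ (λ S₂ → a₁ S₁ * a₂ S₂ + b₁ S₁ * b₂ S₂))
          ≈⟨ Ψ-bilinear w₁ w₂ a₁ a₂ b₁ b₂ ⟩
        Ψ w₁ a₁ * Ψ w₂ a₂ + Ψ w₁ b₁ * Ψ w₂ b₂
          ∎
        where
        γ : Fin (n₁ +ℕ n₂) → Carrier
        γ i = [ γ₁ ∘ fsuc , γ₂ ∘ fsuc ] (splitAt n₁ i)
        w₁ : Fin n₁ → Carrier
        w₁ i = γ₁ (fsuc i) * half
        w₂ : Fin n₂ → Carrier
        w₂ i = γ₂ (fsuc i) * half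
        split-weights : ∀ i → γ i * half ≈ [ w₁ , w₂ ] (splitAt n₁ i)
        split-weights i = reflexive ([,]-∘ (_* half) (splitAt n₁ i))
lemma4 : ∀ {c ℓ} (R : CommutativeRing c ℓ) → let open CommutativeRing R in
  (half : Carrier) → half + half ≈ 1# →
  ∀ {n₁ n₂} (M₁ : Matroid (suc n₁)) (M₂ : Matroid (suc n₂))
  (γ₁ : Fin (suc n₁) → Carrier) (γ₂ : Fin (suc n₂) → Carrier) →
  IsBinary M₁ → IsBinary M₂ →
  ¬ IsLoop M₁ fzero → ¬ IsLoop M₂ fzero →
  (M : Matroid (n₁ +ℕ n₂)) → IsDeltaSum M₁ M₂ M →
  let γ : Fin (n₁ +ℕ n₂) → Carrier
      γ = λ i → [ γ₁ ∘ fsuc , γ₂ ∘ fsuc ] (splitAt n₁ i)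
      z₁d = Ztilde R half (deleteRank M₁) (γ₁ ∘ fsuc)
      z₁c = Ztilde R half (contractRank M₁) (γ₁ ∘ fsuc)
      z₂d = Ztilde R half (deleteRank M₂) (γ₂ ∘ fsuc)
      z₂c = Ztilde R half (contractRank M₂) (γ₂ ∘ fsuc)
  in Ztilde R half (rank M) γ
     ≈ z₁d * ((1# + 1#) * z₂d + (- 1#) * z₂c)
       + z₁c * ((- 1#) * z₂d + 1# * z₂c)
lemma4 R half half+half≈1 M₁ M₂ γ₁ γ₂ (_ , c₁ , rep₁) (_ , c₂ , rep₂) ¬loop₁ ¬loop₂
       M Δ@((_ , cM , repM) , _) =
  begin
    Ztilde R half (rank M) _
      ≈⟨ Ztilde-deltaSum R half half+half≈1 M₁ M₂ M rep₁ rep₂ repM Δ ¬loop₁ γ₁ γ₂ ⟩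
    A₁ * A₂ + B₁ * B₂
      ≈⟨ ≈-sym (matrix-identity R A₁ B₁ A₂ B₂) ⟩
    A₁ * ((1# + 1#) * A₂ + (- 1#) * (A₂ + B₂)) + (A₁ + B₁) * ((- 1#) * A₂ + 1# * (A₂ + B₂))
      ≈⟨ +-cong (*-cong A₁≈z₁d row₂) (*-cong A₁+B₁≈z₁c row₂′) ⟩
    z₁d * ((1# + 1#) * z₂d + (- 1#) * z₂c) + z₁c * ((- 1#) * z₂d + 1# * z₂c)
      ∎
  where
  open CommutativeRing R renaming (refl to ≈-refl; sym to ≈-sym)
  open import Relation.Binary.Reasoning.Setoid setoid
  w₁ = λ i → γ₁ (fsuc i) * half
  w₂ = λ i → γ₂ (fsuc i) * half
  A₁ = Ψ R w₁ (χ R c₁ ∘ (outside ∷_))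
  B₁ = Ψ R w₁ (χ R c₁ ∘ (inside ∷_))
  A₂ = Ψ R w₂ (χ R c₂ ∘ (outside ∷_))
  B₂ = Ψ R w₂ (χ R c₂ ∘ (inside ∷_))
  z₁d = Ztilde R half (deleteRank M₁) (γ₁ ∘ fsuc)
  z₁c = Ztilde R half (contractRank M₁) (γ₁ ∘ fsuc)
  z₂d = Ztilde R half (deleteRank M₂) (γ₂ ∘ fsuc)
  z₂c = Ztilde R half (contractRank M₂) (γ₂ ∘ fsuc)
  A₁≈z₁d : A₁ ≈ z₁d
  A₁≈z₁d = ≈-sym (Ztilde-delete R half half+half≈1 M₁ rep₁ (γ₁ ∘ fsuc))
  A₁+B₁≈z₁c : A₁ + B₁ ≈ z₁c
  A₁+B₁≈z₁c = ≈-sym (Ztilde-contract R half half+half≈1 M₁ rep₁ (γ₁ ∘ fsuc) ¬loop₁)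
  A₂≈z₂d : A₂ ≈ z₂d
  A₂≈z₂d = ≈-sym (Ztilde-delete R half half+half≈1 M₂ rep₂ (γ₂ ∘ fsuc))
  A₂+B₂≈z₂c : A₂ + B₂ ≈ z₂c
  A₂+B₂≈z₂c = ≈-sym (Ztilde-contract R half half+half≈1 M₂ rep₂ (γ₂ ∘ fsuc) ¬loop₂)
  row₂ : (1# + 1#) * A₂ + (- 1#) * (A₂ + B₂) ≈ (1# + 1#) * z₂d + (- 1#) * z₂c
  row₂ = +-cong (*-cong ≈-refl A₂≈z₂d) (*-cong ≈-refl A₂+B₂≈z₂c)
  row₂′ : (- 1#) * A₂ + 1# * (A₂ + B₂) ≈ (- 1#) * z₂d + 1# * z₂c
  row₂′ = +-cong (*-cong ≈-refl A₂≈z₂d) (*-cong ≈-refl A₂+B₂≈z₂c)
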